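{- For the grid graph $G=P_s\times P_t$ with $s\ge t\ge 2$, $\dim_{1,f}(G)=\dim_f(G)$ if and only if $G\in\{P_2\times P_2,\ P_3\times P_2,\ P_4\times P_2,\ P_3\times P_3\}$.
   Context: $P_s\times P_t$ denotes the Cartesian product of the paths on $s$ and $t$ vertices. $d(x,y)$ denotes the distance. For $g$ defined on $V(G)$ and $U\subseteq V(G)$, $g(U)=\sum_{s\in U}g(s)$. For distinct $x,y$, $R\{x,y\}=\{z: d(x,z)\ne d(y,z)\}$; $g:V(G)\to[0,1]$ is a resolving function if $g(R\{x,y\})\ge1$ for all distinct $x,y$, and $\dim_f(G)$ is the minimum of $g(V(G))$ over resolving functions. Let $d_1(x,y)=\min\{d(x,y),2\}$, $R_1\{x,y\}=\{z: d_1(x,z)\neq d_1(y,z)\}$; $h:V(G)\to[0,1]$ is a $1$-truncated resolving function if $h(R_1\{x,y\})\ge 1$ for all distinct $x,y$; $\dim_{1,f}(G)$ is the minimum of $h(V(G))$ over such $h$.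
   Formalization: Resolving functions and 1-truncated resolving functions take rational values in $[0,1]$ rather than real ones, so $\dim_f(G)$ and $\dim_{1,f}(G)$ are minima over such functions. -}

module Defs where

open import Data.Nat as ℕ using (ℕ; _⊓_; ∣_-_∣; _≡ᵇ_)
open import Data.Fin using (Fin; toℕ)
open import Data.List using (List; cartesianProduct; foldr; map)
open import Data.List using () renaming (allFin to allFinL)
open import Data.Product using (_×_; _,_; Σ)
open import Data.Bool using (Bool; if_then_else_; not)
open import Data.Rational using (ℚ; 0ℚ; 1ℚ; _+_; _≤_)
open import Relation.Binary.PropositionalEquality using (_≡_; _≢_)

Vertex : ℕ → ℕ → Set
Vertex s t = Fin s × Fin t

vertices : (s t : ℕ) → List (Vertex s t)
vertices s t = cartesianProduct (allFinL s) (allFinL t)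

-- Graph distance in P_s × P_t (the Cartesian product of paths):
-- the sum of the distances in the factors, i.e. the Manhattan distance.
dist : {s t : ℕ} → Vertex s t → Vertex s t → ℕ
dist (a , b) (c , d) = ∣ toℕ a - toℕ c ∣ ℕ.+ ∣ toℕ b - toℕ d ∣

dist₁ : {s t : ℕ} → Vertex s t → Vertex s t → ℕ
dist₁ x y = dist x y ⊓ 2

total : {s t : ℕ} → (Vertex s t → ℚ) → ℚ
total {s} {t} g = foldr _+_ 0ℚ (map g (vertices s t))

weightR : {s t : ℕ} → (Vertex s t → Vertex s t → ℕ) →
          (Vertex s t → ℚ) → Vertex s t → Vertex s t → ℚ
weightR {s} {t} D g x y =
  foldr _+_ 0ℚ (map (λ z → if not (D x z ≡ᵇ D y z) then g z else 0ℚ) (vertices s t))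

IsResolvingFn : {s t : ℕ} → (Vertex s t → Vertex s t → ℕ) → (Vertex s t → ℚ) → Set
IsResolvingFn D g =
  (∀ z → (0ℚ ≤ g z) × (g z ≤ 1ℚ)) ×
  (∀ x y → x ≢ y → 1ℚ ≤ weightR D g x y)

IsMinResolving : {s t : ℕ} → (Vertex s t → Vertex s t → ℕ) → ℚ → Set
IsMinResolving D r =
  Σ (_ → ℚ) (λ g → IsResolvingFn D g × (total g ≡ r)) ×
  (∀ g → IsResolvingFn D g → r ≤ total g)

IsFracDim : (s t : ℕ) → ℚ → Set
IsFracDim s t r = IsMinResolving {s} {t} dist r

IsFracDim₁ : (s t : ℕ) → ℚ → Set
IsFracDim₁ s t r = IsMinResolving {s} {t} dist₁ r

module Submission where

-- dim_f ≤ 2 on every grid, since the two ends of one side form a resolving set, and dim_f ≤ dim_{1,f}, since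
-- truncating distances only shrinks the sets R{x,y}. Lower bounds come from the dual linear program: if every
-- vertex resolves at most k of the pairs in a list P, then summing g(R{x,y}) ≥ 1 over P gives |P| ≤ k · g(V).
-- The two diagonals of a corner square are resolved by disjoint sets of vertices, so dim_f ≥ 2. Under d_1 only
-- vertices within distance 1 of x or y resolve {x,y}, so for s ≥ 5 a vertical pair in the last column can be
-- added to the two diagonals, and dim_{1,f} ≥ 3. For 4×3 and 4×4, packings with |P|/k > 2, and for the four
-- exceptional grids, 1-truncated resolving functions of weight 2, are verified by evaluation.

module ListSum where

  open import Data.Nat as ℕ using (ℕ; zero; suc; z≤n; s≤s)
  import Data.Nat.Properties as ℕₚ
  open import Data.List using (List; []; _∷_; foldr; map; length; filter)
  open import Data.List.Properties using (map-cong; filter-none)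
  open import Data.List.Membership.Propositional using (_∈_)
  open import Data.List.Relation.Unary.All as All using (All; []; _∷_)
  open import Data.List.Relation.Unary.AllPairs using (AllPairs; []; _∷_)
  open import Data.List.Relation.Unary.Any using (here; there)
  open import Data.Product using (_×_; _,_)
  open import Data.Bool using (true; false; if_then_else_)
  import Data.Rational
  open import Data.Rational using (ℚ; 0ℚ; _+_; _≤_)
  open import Data.Rational.Properties as ℚ using (≤-refl; +-mono-≤; +-identityˡ; +-identityʳ)
  open import Algebra.Definitions.RawMonoid Data.Rational.+-0-rawMonoid using () renaming (_×_ to _·_)
  open import Algebra.Bundles using (CommutativeMonoid)
  open import Algebra.Properties.CommutativeSemigroup
    (CommutativeMonoid.commutativeSemigroup ℚ.+-0-commutativeMonoid) using (interchange)
  open import Relation.Binary.PropositionalEquality using (_≡_; refl; sym; trans; cong; subst)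
  open import Relation.Nullary using (¬_; does; yes; no)
  open import Relation.Unary using (Pred; Decidable)

  ∑ : {A : Set} → List A → (A → ℚ) → ℚ
  ∑ L f = foldr _+_ 0ℚ (map f L)

  module _ {A : Set} where

    ∑-cong : (L : List A) {f g : A → ℚ} → (∀ a → f a ≡ g a) → ∑ L f ≡ ∑ L g
    ∑-cong L f≗g = cong (foldr _+_ 0ℚ) (map-cong f≗g L)

    ∑-zero : (L : List A) → ∑ L (λ _ → 0ℚ) ≡ 0ℚ
    ∑-zero []      = refl
    ∑-zero (_ ∷ L) = trans (+-identityˡ _) (∑-zero L)

    ∑-distrib-+ : (L : List A) (f g : A → ℚ) → ∑ L (λ a → f a + g a) ≡ ∑ L f + ∑ L g
    ∑-distrib-+ []      f g = sym (+-identityˡ 0ℚ)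
    ∑-distrib-+ (a ∷ L) f g = trans (cong (f a + g a +_) (∑-distrib-+ L f g)) (interchange (f a) (g a) _ _)

    ∑-const : (L : List A) (q : ℚ) → ∑ L (λ _ → q) ≡ length L · q
    ∑-const []      q = refl
    ∑-const (_ ∷ L) q = cong (q +_) (∑-const L q)

    ∑-· : (L : List A) (n : ℕ) (f : A → ℚ) → ∑ L (λ a → n · f a) ≡ n · ∑ L f
    ∑-· L zero    f = ∑-zero L
    ∑-· L (suc n) f = trans (∑-distrib-+ L f (λ a → n · f a)) (cong (∑ L f +_) (∑-· L n f))

    ∑-if : ∀ {p} {P : Pred A p} (P? : Decidable P) (L : List A) (q : ℚ) →
           ∑ L (λ a → if does (P? a) then q else 0ℚ) ≡ length (filter P? L) · q
    ∑-if P? []      q = refl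
    ∑-if P? (a ∷ L) q with does (P? a)
    ... | true  = cong (q +_) (∑-if P? L q)
    ... | false = trans (+-identityˡ _) (∑-if P? L q)

    ∑-nonneg : (L : List A) {f : A → ℚ} → (∀ a → 0ℚ ≤ f a) → 0ℚ ≤ ∑ L f
    ∑-nonneg []      f≥0 = ≤-refl
    ∑-nonneg (a ∷ L) f≥0 = +-mono-≤ (f≥0 a) (∑-nonneg L f≥0)

    ∑-mono-≤ : {L : List A} {f g : A → ℚ} → All (λ a → f a ≤ g a) L → ∑ L f ≤ ∑ L g
    ∑-mono-≤ []         = ≤-refl
    ∑-mono-≤ (fa≤ga ∷ ps) = +-mono-≤ fa≤ga (∑-mono-≤ ps)

    term≤∑ : {L : List A} {f : A → ℚ} → (∀ a → 0ℚ ≤ f a) → ∀ {a} → a ∈ L → f a ≤ ∑ L f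
    term≤∑ {a ∷ L} {f} f≥0 (here refl) =
      subst (_≤ f a + ∑ L f) (+-identityʳ (f a)) (ℚ.+-monoʳ-≤ (f a) (∑-nonneg L f≥0))
    term≤∑ {b ∷ L} {f} f≥0 (there a∈L) =
      subst (_≤ f b + ∑ L f) (+-identityˡ _) (+-mono-≤ (f≥0 b) (term≤∑ f≥0 a∈L))

  module _ {A B : Set} where

    ∑-comm : (L : List A) (M : List B) (f : A → B → ℚ) →
             ∑ L (λ a → ∑ M (f a)) ≡ ∑ M (λ b → ∑ L (λ a → f a b))
    ∑-comm []      M f = sym (∑-zero M)
    ∑-comm (a ∷ L) M f = trans (cong (∑ M (f a) +_) (∑-comm L M f)) (sym (∑-distrib-+ M (f a) _))

  ·-nonneg : ∀ n {q} → 0ℚ ≤ q → 0ℚ ≤ n · q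
  ·-nonneg zero    q≥0 = ≤-refl
  ·-nonneg (suc n) q≥0 = +-mono-≤ q≥0 (·-nonneg n q≥0)

  ·-monoˡ-≤ : ∀ {m n q} → 0ℚ ≤ q → m ℕ.≤ n → m · q ≤ n · q
  ·-monoˡ-≤ {n = n} q≥0 z≤n       = ·-nonneg n q≥0
  ·-monoˡ-≤ {q = q} q≥0 (s≤s m≤n) = ℚ.+-monoʳ-≤ q (·-monoˡ-≤ q≥0 m≤n)

  ·-monoʳ-≤ : ∀ n {p q} → p ≤ q → n · p ≤ n · q
  ·-monoʳ-≤ zero    p≤q = ≤-refl
  ·-monoʳ-≤ (suc n) p≤q = +-mono-≤ p≤q (·-monoʳ-≤ n p≤q)

  length-filter≤1 : ∀ {A : Set} {p} {P : Pred A p} (P? : Decidable P) {L : List A} →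
                    AllPairs (λ a b → ¬ (P a × P b)) L → length (filter P? L) ℕ.≤ 1
  length-filter≤1 P? []                      = z≤n
  length-filter≤1 P? {a ∷ L} (excl ∷ exclusive) with P? a
  ... | yes Pa = s≤s (ℕₚ.≤-reflexive (cong length (filter-none P? (All.map (λ ex Pb → ex (Pa , Pb)) excl))))
  ... | no  _  = length-filter≤1 P? exclusive

module GridResolution where

  open import Defs
  open ListSum
  open import Data.Nat as ℕ using (ℕ; zero; suc; z≤n; s≤s; _⊓_; ∣_-_∣)
  import Data.Nat.Properties as ℕₚ
  open import Data.Fin as Fin using (toℕ; fromℕ; #_)
  open import Data.Fin.Properties using (all?; toℕ≤pred[n]; toℕ-fromℕ; toℕ-injective) renaming (_≟_ to _≟ᶠ_)
  open import Data.List using (List; []; _∷_; length; filter)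
  open import Data.List.Membership.Propositional using (_∈_; find)
  open import Data.List.Membership.Propositional.Properties using (∈-cartesianProduct⁺; ∈-allFin)
  open import Data.List.Relation.Unary.All as All using (All; []; _∷_)
  open import Data.List.Relation.Unary.AllPairs as AllPairs using (AllPairs; []; _∷_)
  open import Data.List.Relation.Unary.Any using (Any; here; there; any?)
  open import Data.List.Relation.Unary.Unique.Propositional using (Unique)
  open import Data.List.Relation.Unary.Unique.Propositional.Properties using (cartesianProduct⁺; allFin⁺)
  open import Data.Product using (_×_; _,_; proj₁; proj₂)
  open import Data.Product.Properties using (≡-dec)
  open import Data.Sum using (_⊎_; inj₁; inj₂; [_,_]′)
  open import Data.Bool using (true; false; if_then_else_)
  open import Data.Empty using (⊥-elim)
  open import Data.Rational using (ℚ; 0ℚ; 1ℚ; ½; _≤_; _<_)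
  open import Data.Rational.Properties as ℚ using (≤-refl; ≤-trans)
  import Data.Rational
  open import Algebra.Definitions.RawMonoid Data.Rational.+-0-rawMonoid using () renaming (_×_ to _·_)
  open import Relation.Binary.PropositionalEquality using (_≡_; _≢_; refl; sym; trans; cong; cong₂; subst)
  open import Relation.Binary.Definitions using (DecidableEquality; tri<; tri≈; tri>)
  open import Relation.Nullary using (¬_; Dec; yes; no; does; ¬?; _×-dec_; _→-dec_)
  open import Relation.Nullary.Decidable using (map′; dec-true; True; toWitness; from-yes)
  open import Relation.Unary using (Pred; Decidable)
  open import Function using (_∘_)

  module _ {s t : ℕ} where

    _≟ᵥ_ : DecidableEquality (Vertex s t)
    _≟ᵥ_ = ≡-dec _≟ᶠ_ _≟ᶠ_

    vertices-unique : Unique (vertices s t)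
    vertices-unique = cartesianProduct⁺ (allFin⁺ s) (allFin⁺ t)

    ∈-vertices : (z : Vertex s t) → z ∈ vertices s t
    ∈-vertices (a , b) = ∈-cartesianProduct⁺ (∈-allFin a) (∈-allFin b)

    ∀-vertex? : ∀ {p} {P : Pred (Vertex s t) p} → Decidable P → Dec (∀ z → P z)
    ∀-vertex? P? = map′ (λ ∀P z → ∀P (proj₁ z) (proj₂ z)) (λ ∀P a b → ∀P (a , b))
                        (all? λ a → all? λ b → P? (a , b))

  Distance : ℕ → ℕ → Set
  Distance s t = Vertex s t → Vertex s t → ℕ

  Pair : ℕ → ℕ → Set
  Pair s t = Vertex s t × Vertex s t

  module _ {s t : ℕ} where

    Resolves : Distance s t → Vertex s t → Pred (Pair s t) _
    Resolves D z p = D (proj₁ p) z ≢ D (proj₂ p) z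

    resolves? : (D : Distance s t) (z : Vertex s t) → Decidable (Resolves D z)
    resolves? D z p = ¬? (D (proj₁ p) z ℕ.≟ D (proj₂ p) z)

  0≤1 : 0ℚ ≤ 1ℚ
  0≤1 = ℚ.nonNegative⁻¹ 1ℚ

  if-nonneg : ∀ {q} → 0ℚ ≤ q → ∀ b → 0ℚ ≤ (if b then q else 0ℚ)
  if-nonneg q≥0 true  = q≥0
  if-nonneg q≥0 false = ≤-refl

  if-dec-yes : ∀ {a} {A : Set a} (a? : Dec A) → A → ∀ {p q : ℚ} → (if does a? then p else q) ≡ p
  if-dec-yes a? a = cong (λ b → if b then _ else _) (dec-true a? a)

  if-dec-mono : ∀ {a b} {A : Set a} {B : Set b} (a? : Dec A) (b? : Dec B) → (A → B) →
                ∀ {q} → 0ℚ ≤ q → (if does a? then q else 0ℚ) ≤ (if does b? then q else 0ℚ)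
  if-dec-mono (yes _) (yes _) _   _   = ≤-refl
  if-dec-mono (yes a) (no ¬b) a⇒b _   = ⊥-elim (¬b (a⇒b a))
  if-dec-mono (no _)  (yes _) _   q≥0 = q≥0
  if-dec-mono (no _)  (no _)  _   _   = ≤-refl

  module _ {s t : ℕ} {D : Distance s t} {g : Vertex s t → ℚ} where

    weightR-≥ : (∀ z → 0ℚ ≤ g z) → ∀ {w} p → Resolves D w p → g w ≤ weightR D g (proj₁ p) (proj₂ p)
    weightR-≥ g≥0 {w} p res = subst (_≤ weightR D g (proj₁ p) (proj₂ p)) (if-dec-yes (resolves? D w p) res)
      (term≤∑ (λ z → if-nonneg (g≥0 z) (does (resolves? D z p))) (∈-vertices w))

  module _ {s t : ℕ} where

    uniformOn : ℚ → List (Vertex s t) → Vertex s t → ℚ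
    uniformOn q W z = if does (any? (z ≟ᵥ_) W) then q else 0ℚ

    uniformOn-bounds : ∀ {q} → 0ℚ ≤ q → q ≤ 1ℚ → ∀ W z → (0ℚ ≤ uniformOn q W z) × (uniformOn q W z ≤ 1ℚ)
    uniformOn-bounds q≥0 q≤1 W z with does (any? (z ≟ᵥ_) W)
    ... | true  = q≥0 , q≤1
    ... | false = ≤-refl , 0≤1

    uniformOn≤∑ : ∀ {q} → 0ℚ ≤ q → ∀ W z → uniformOn q W z ≤ ∑ W (λ w → if does (z ≟ᵥ w) then q else 0ℚ)
    uniformOn≤∑ {q} q≥0 W z with any? (z ≟ᵥ_) W
    ... | yes z∈W = subst (_≤ ∑ W at-z) (if-dec-yes (z ≟ᵥ z) refl) (term≤∑ at-z≥0 z∈W)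
      where
      at-z : Vertex s t → ℚ
      at-z w = if does (z ≟ᵥ w) then q else 0ℚ
      at-z≥0 : ∀ w → 0ℚ ≤ at-z w
      at-z≥0 w = if-nonneg q≥0 (does (z ≟ᵥ w))
    ... | no  _   = ∑-nonneg W (λ w → if-nonneg q≥0 (does (z ≟ᵥ w)))

    total-uniformOn : ∀ {q} → 0ℚ ≤ q → ∀ W → total (uniformOn q W) ≤ length W · q
    total-uniformOn {q} q≥0 W = begin
      ∑ V (uniformOn q W)                                        ≤⟨ ∑-mono-≤ (All.universal (uniformOn≤∑ q≥0 W) V) ⟩
      ∑ V (λ z → ∑ W (λ w → if does (z ≟ᵥ w) then q else 0ℚ))   ≡⟨ ∑-comm V W _ ⟩
      ∑ W (λ w → ∑ V (λ z → if does (z ≟ᵥ w) then q else 0ℚ))   ≡⟨ ∑-cong W (λ w → ∑-if (_≟ᵥ w) V q) ⟩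
      ∑ W (λ w → length (filter (_≟ᵥ w) V) · q)                  ≤⟨ ∑-mono-≤ (All.universal (λ w → ·-monoˡ-≤ q≥0 (at-most-once w)) W) ⟩
      ∑ W (λ _ → 1 · q)                                           ≡⟨ ∑-const W (1 · q) ⟩
      length W · (1 · q)                                          ≡⟨ cong (length W ·_) (ℚ.+-identityʳ q) ⟩
      length W · q                                                ∎
      where
      open ℚ.≤-Reasoning
      V = vertices s t
      at-most-once : ∀ w → length (filter (_≟ᵥ w) V) ℕ.≤ 1
      at-most-once w = length-filter≤1 (_≟ᵥ w)
        (AllPairs.map (λ z≢z′ (z≡w , z′≡w) → z≢z′ (trans z≡w (sym z′≡w))) vertices-unique)

    IsResolvingSet : Distance s t → List (Vertex s t) → Set
    IsResolvingSet D W = ∀ x y → x ≢ y → Any (λ w → Resolves D w (x , y)) W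

    resolvingSet⇒resolvingFn : ∀ {D W} → IsResolvingSet D W → IsResolvingFn D (uniformOn 1ℚ W)
    resolvingSet⇒resolvingFn {D} {W} resolving = uniformOn-bounds 0≤1 ≤-refl W , weight≥1
      where
      weight≥1 : ∀ x y → x ≢ y → 1ℚ ≤ weightR D (uniformOn 1ℚ W) x y
      weight≥1 x y x≢y with find (resolving x y x≢y)
      ... | w , w∈W , res = subst (_≤ weightR D (uniformOn 1ℚ W) x y) (if-dec-yes (any? (w ≟ᵥ_) W) w∈W)
                              (weightR-≥ {D = D} (λ z → proj₁ (uniformOn-bounds 0≤1 ≤-refl W z)) (x , y) res)

    min≤resolvingSetSize : ∀ {D W r} → IsResolvingSet D W → IsMinResolving D r → r ≤ length W · 1ℚ
    min≤resolvingSetSize {W = W} resolving (_ , minimal) =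
      ≤-trans (minimal _ (resolvingSet⇒resolvingFn resolving)) (total-uniformOn 0≤1 W)

  module _ {s t : ℕ} {D : Distance s t} (φ : ℕ → ℕ) where

    private
      φD : Distance s t
      φD x y = φ (D x y)

    resolves-coarsen : ∀ z p → Resolves φD z p → Resolves D z p
    resolves-coarsen _ _ φ-differ differ = φ-differ (cong φ differ)

    resolvingFn-coarsen : ∀ {g} → IsResolvingFn φD g → IsResolvingFn D g
    resolvingFn-coarsen {g} (bounds , weight≥1) = bounds , λ x y x≢y →
      ≤-trans (weight≥1 x y x≢y) (∑-mono-≤ (All.universal (restriction-mono (x , y)) (vertices s t)))
      where
      restriction-mono : ∀ p z → (if does (resolves? φD z p) then g z else 0ℚ)
                               ≤ (if does (resolves? D z p) then g z else 0ℚ)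
      restriction-mono p z = if-dec-mono (resolves? φD z p) (resolves? D z p) (resolves-coarsen z p) (proj₁ (bounds z))

    min≤min-coarsen : ∀ {r r′} → IsMinResolving D r → IsMinResolving φD r′ → r ≤ r′
    min≤min-coarsen (_ , minimal) ((g , resolving , total≡r′) , _) =
      subst (_ ≤_) total≡r′ (minimal g (resolvingFn-coarsen resolving))

  module _ {s t : ℕ} (D : Distance s t) where

    resolves₁⇒close : ∀ z x y → Resolves (λ u v → D u v ⊓ 2) z (x , y) → D x z ℕ.≤ 1 ⊎ D y z ℕ.≤ 1
    resolves₁⇒close z x y differ with D x z ℕ.≤? 1 | D y z ℕ.≤? 1
    ... | yes x-close | _           = inj₁ x-close
    ... | no  _       | yes y-close = inj₂ y-close
    ... | no  x-far   | no  y-far   =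
      ⊥-elim (differ (trans (ℕₚ.m≥n⇒m⊓n≡n (ℕₚ.≰⇒> x-far)) (sym (ℕₚ.m≥n⇒m⊓n≡n (ℕₚ.≰⇒> y-far)))))

    IsPacking : ℕ → List (Pair s t) → Set
    IsPacking k P = All (λ p → proj₁ p ≢ proj₂ p) P × (∀ z → length (filter (resolves? D z) P) ℕ.≤ k)

    packing-bound : ∀ {k P g} → IsPacking k P → IsResolvingFn D g → length P · 1ℚ ≤ k · total g
    packing-bound {k} {P} {g} (distinct , sparse) (bounds , weight≥1) = begin
      length P · 1ℚ                                                  ≡⟨ sym (∑-const P 1ℚ) ⟩
      ∑ P (λ _ → 1ℚ)                                                 ≤⟨ ∑-mono-≤ (All.map (weight≥1 _ _) distinct) ⟩
      ∑ P (λ p → ∑ V (λ z → if does (resolves? D z p) then g z else 0ℚ)) ≡⟨ ∑-comm P V _ ⟩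
      ∑ V (λ z → ∑ P (λ p → if does (resolves? D z p) then g z else 0ℚ)) ≡⟨ ∑-cong V (λ z → ∑-if (resolves? D z) P (g z)) ⟩
      ∑ V (λ z → length (filter (resolves? D z) P) · g z)            ≤⟨ ∑-mono-≤ (All.universal (λ z → ·-monoˡ-≤ (proj₁ (bounds z)) (sparse z)) V) ⟩
      ∑ V (λ z → k · g z)                                            ≡⟨ ∑-· V k g ⟩
      k · total g                                                    ∎
      where
      open ℚ.≤-Reasoning
      V = vertices s t

    packing⇒≤min : ∀ {k P r} → IsPacking k P → IsMinResolving D r → length P · 1ℚ ≤ k · r
    packing⇒≤min {k} {P} packing ((g , resolving , total≡r) , _) =
      subst (λ r → length P · 1ℚ ≤ k · r) total≡r (packing-bound packing resolving)

    packing⇒<min : ∀ {k P q r} → IsPacking k P → k · q < length P · 1ℚ → IsMinResolving D r → q < r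
    packing⇒<min {k} packing gap min = ℚ.≰⇒> λ r≤q →
      ℚ.<-irrefl refl (ℚ.<-≤-trans gap (≤-trans (packing⇒≤min packing min) (·-monoʳ-≤ k r≤q)))

    exclusive⇒packing : ∀ {P} → All (λ p → proj₁ p ≢ proj₂ p) P →
      (∀ z → AllPairs (λ p p′ → ¬ (Resolves D z p × Resolves D z p′)) P) → IsPacking 1 P
    exclusive⇒packing distinct exclusive = distinct , λ z → length-filter≤1 (resolves? D z) (exclusive z)

    isPacking? : ∀ k P → Dec (IsPacking k P)
    isPacking? k P = All.all? (λ p → ¬? (proj₁ p ≟ᵥ proj₂ p)) P
               ×-dec ∀-vertex? (λ z → length (filter (resolves? D z) P) ℕ.≤? k)

    isResolvingFn? : ∀ g → Dec (IsResolvingFn D g)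
    isResolvingFn? g = ∀-vertex? (λ z → (0ℚ ℚ.≤? g z) ×-dec (g z ℚ.≤? 1ℚ))
                 ×-dec ∀-vertex? (λ x → ∀-vertex? (λ y → ¬? (x ≟ᵥ y) →-dec (1ℚ ℚ.≤? weightR D g x y)))

  fracDim≤fracDim₁ : ∀ {s t r r₁} → IsFracDim s t r → IsFracDim₁ s t r₁ → r ≤ r₁
  fracDim≤fracDim₁ = min≤min-coarsen {D = dist} (_⊓ 2)

  offsets-unequal : ∀ {S a a′ b b′} → a ℕ.< a′ → a′ ℕ.≤ S →
                    a ℕ.+ b ≡ a′ ℕ.+ b′ → (S ℕ.∸ a) ℕ.+ b ≢ (S ℕ.∸ a′) ℕ.+ b′
  offsets-unequal {b = b} {b′} a<a′ a′≤S e₀ e₁ with ℕₚ.≤-<-connex b b′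
  ... | inj₁ b≤b′ = ℕₚ.<-irrefl e₀ (ℕₚ.+-mono-<-≤ a<a′ b≤b′)
  ... | inj₂ b′<b = ℕₚ.<-irrefl (sym e₁) (ℕₚ.+-mono-< (ℕₚ.∸-monoʳ-< a<a′ a′≤S) b′<b)

  offsets-injective : ∀ {S a a′ b b′} → a ℕ.≤ S → a′ ℕ.≤ S →
                      a ℕ.+ b ≡ a′ ℕ.+ b′ → (S ℕ.∸ a) ℕ.+ b ≡ (S ℕ.∸ a′) ℕ.+ b′ → a ≡ a′
  offsets-injective {a = a} {a′} a≤S a′≤S e₀ e₁ with ℕₚ.<-cmp a a′
  ... | tri< a<a′ _ _ = ⊥-elim (offsets-unequal a<a′ a′≤S e₀ e₁)
  ... | tri≈ _ a≡a′ _ = a≡a′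
  ... | tri> _ _ a′<a = ⊥-elim (offsets-unequal a′<a a≤S (sym e₀) (sym e₁))

  module _ {s t : ℕ} where

    origin lastCorner : Vertex (suc s) (suc t)
    origin     = Fin.zero , Fin.zero
    lastCorner = fromℕ s  , Fin.zero

    corners : List (Vertex (suc s) (suc t))
    corners = origin ∷ lastCorner ∷ []

    dist-origin : ∀ a b → dist (a , b) origin ≡ toℕ a ℕ.+ toℕ b
    dist-origin a b = cong₂ ℕ._+_ (ℕₚ.∣-∣-identityʳ (toℕ a)) (ℕₚ.∣-∣-identityʳ (toℕ b))

    dist-lastCorner : ∀ a b → dist (a , b) lastCorner ≡ (s ℕ.∸ toℕ a) ℕ.+ toℕ b
    dist-lastCorner a b = cong₂ ℕ._+_
      (trans (cong (∣ toℕ a -_∣) (toℕ-fromℕ s)) (ℕₚ.m≤n⇒∣m-n∣≡n∸m (toℕ≤pred[n] a)))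
      (ℕₚ.∣-∣-identityʳ (toℕ b))

    corners-resolving : IsResolvingSet dist corners
    corners-resolving x y x≢y with dist x origin ℕ.≟ dist y origin
                                 | dist x lastCorner ℕ.≟ dist y lastCorner
    ... | no differ | _         = here differ
    ... | yes _     | no differ = there (here differ)
    ... | yes e₀    | yes e₁    = ⊥-elim (x≢y (equal-corner-distances x y e₀ e₁))
      where
      equal-corner-distances : ∀ x y → dist x origin ≡ dist y origin →
                               dist x lastCorner ≡ dist y lastCorner → x ≡ y
      equal-corner-distances (a , b) (a′ , b′) e₀ e₁ = cong₂ _,_ (toℕ-injective a≡a′) (toℕ-injective b≡b′)
        where
        e₀′ : toℕ a ℕ.+ toℕ b ≡ toℕ a′ ℕ.+ toℕ b′
        e₀′ = trans (sym (dist-origin a b)) (trans e₀ (dist-origin a′ b′))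
        e₁′ : (s ℕ.∸ toℕ a) ℕ.+ toℕ b ≡ (s ℕ.∸ toℕ a′) ℕ.+ toℕ b′
        e₁′ = trans (sym (dist-lastCorner a b)) (trans e₁ (dist-lastCorner a′ b′))
        a≡a′ : toℕ a ≡ toℕ a′
        a≡a′ = offsets-injective (toℕ≤pred[n] a) (toℕ≤pred[n] a′) e₀′ e₁′
        b≡b′ : toℕ b ≡ toℕ b′
        b≡b′ = ℕₚ.+-cancelˡ-≡ (toℕ a) _ _ (trans e₀′ (cong (ℕ._+ toℕ b′) (sym a≡a′)))

    fracDim≤2 : ∀ {r} → IsFracDim (suc s) (suc t) r → r ≤ 2 · 1ℚ
    fracDim≤2 = min≤resolvingSetSize corners-resolving

  module _ {s t : ℕ} where

    cornerDiagonal cornerAntidiagonal : Pair (2 ℕ.+ s) (2 ℕ.+ t)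
    cornerDiagonal     = (Fin.zero , Fin.zero)     , (Fin.suc Fin.zero , Fin.suc Fin.zero)
    cornerAntidiagonal = (Fin.zero , Fin.suc Fin.zero) , (Fin.suc Fin.zero , Fin.zero)

    cornerDiagonals-exclusive : ∀ z → ¬ (Resolves dist z cornerDiagonal × Resolves dist z cornerAntidiagonal)
    cornerDiagonals-exclusive (Fin.zero  , Fin.zero)  (_ , anti) = anti refl
    cornerDiagonals-exclusive (Fin.zero  , Fin.suc _) (diag , _) = diag refl
    cornerDiagonals-exclusive (Fin.suc c , Fin.zero)  (diag , _) = diag (sym (ℕₚ.+-suc (toℕ c) 0))
    cornerDiagonals-exclusive (Fin.suc c , Fin.suc e) (_ , anti) = anti (sym (ℕₚ.+-suc (toℕ c) (toℕ e)))

    2≤fracDim : ∀ {r} → IsFracDim (2 ℕ.+ s) (2 ℕ.+ t) r → 2 · 1ℚ ≤ r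
    2≤fracDim {r} dim = subst (2 · 1ℚ ≤_) (ℚ.+-identityʳ r) (packing⇒≤min dist cornerPacking dim)
      where
      cornerPacking : IsPacking dist 1 (cornerDiagonal ∷ cornerAntidiagonal ∷ [])
      cornerPacking = exclusive⇒packing dist ((λ ()) ∷ (λ ()) ∷ [])
                        (λ z → (cornerDiagonals-exclusive z ∷ []) ∷ [] ∷ [])

  module _ {s t : ℕ} where

    column : Vertex s t → ℕ
    column = toℕ ∘ proj₁

    ∣column-column∣≤dist : ∀ u v → ∣ column u - column v ∣ ℕ.≤ dist u v
    ∣column-column∣≤dist (a , b) (c , d) = ℕₚ.m≤m+n _ _

    resolves₁⇒column≤ : ∀ z x y {a} → Resolves dist₁ z (x , y) →
                        column x ℕ.≤ a → column y ℕ.≤ a → column z ℕ.≤ a ℕ.+ 1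
    resolves₁⇒column≤ z x y {a} differ x≤a y≤a =
      [ near x x≤a , near y y≤a ]′ (resolves₁⇒close dist z x y differ)
      where
      near : ∀ u → column u ℕ.≤ a → dist u z ℕ.≤ 1 → column z ℕ.≤ a ℕ.+ 1
      near u u≤a close = ℕₚ.≤-trans (ℕₚ.m≤n+∣n-m∣ (column z) (column u))
                             (ℕₚ.+-mono-≤ u≤a (ℕₚ.≤-trans (∣column-column∣≤dist u z) close))

    resolves₁⇒column≥ : ∀ z x y {a} → Resolves dist₁ z (x , y) →
                        a ℕ.≤ column x → a ℕ.≤ column y → a ℕ.≤ column z ℕ.+ 1
    resolves₁⇒column≥ z x y {a} differ a≤x a≤y =
      [ near x a≤x , near y a≤y ]′ (resolves₁⇒close dist z x y differ)
      where
      near : ∀ u → a ℕ.≤ column u → dist u z ℕ.≤ 1 → a ℕ.≤ column z ℕ.+ 1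
      near u a≤u close = ℕₚ.≤-trans a≤u (ℕₚ.≤-trans (ℕₚ.m≤n+∣m-n∣ (column u) (column z))
                             (ℕₚ.+-monoʳ-≤ (column z) (ℕₚ.≤-trans (∣column-column∣≤dist u z) close)))

  module _ {n m : ℕ} where

    lastColumnPair : Pair (5 ℕ.+ n) (2 ℕ.+ m)
    lastColumnPair = (fromℕ (4 ℕ.+ n) , Fin.zero) , (fromℕ (4 ℕ.+ n) , Fin.suc Fin.zero)

    lastColumn-exclusive : ∀ z p → column (proj₁ p) ℕ.≤ 1 → column (proj₂ p) ℕ.≤ 1 →
                           ¬ (Resolves dist₁ z lastColumnPair × Resolves dist₁ z p)
    lastColumn-exclusive z p x≤1 y≤1 (by-last , by-p) = ℕₚ.≤⇒≯ 4+n≤3 (ℕₚ.m≤m+n 4 n)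
      where
      4+n≤last : 4 ℕ.+ n ℕ.≤ column (proj₁ lastColumnPair)
      4+n≤last = ℕₚ.≤-reflexive (sym (toℕ-fromℕ (4 ℕ.+ n)))
      4+n≤column+1 : 4 ℕ.+ n ℕ.≤ column z ℕ.+ 1
      4+n≤column+1 = resolves₁⇒column≥ z (proj₁ lastColumnPair) (proj₂ lastColumnPair) by-last 4+n≤last 4+n≤last
      column≤2 : column z ℕ.≤ 1 ℕ.+ 1
      column≤2 = resolves₁⇒column≤ z (proj₁ p) (proj₂ p) by-p x≤1 y≤1
      4+n≤3 : 4 ℕ.+ n ℕ.≤ 3
      4+n≤3 = ℕₚ.≤-trans 4+n≤column+1 (ℕₚ.+-monoˡ-≤ 1 column≤2)

    cornerAndLastColumnPacking : IsPacking dist₁ 1 (lastColumnPair ∷ cornerDiagonal ∷ cornerAntidiagonal ∷ [])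
    cornerAndLastColumnPacking = exclusive⇒packing dist₁ ((λ ()) ∷ (λ ()) ∷ (λ ()) ∷ []) λ z →
        (  lastColumn-exclusive z cornerDiagonal z≤n (s≤s z≤n)
         ∷ lastColumn-exclusive z cornerAntidiagonal z≤n (s≤s z≤n) ∷ [])
      ∷ (cornerDiagonals₁-exclusive z ∷ [])
      ∷ []
      ∷ []
      where
      cornerDiagonals₁-exclusive : ∀ z → ¬ (Resolves dist₁ z cornerDiagonal × Resolves dist₁ z cornerAntidiagonal)
      cornerDiagonals₁-exclusive z (diag , anti) = cornerDiagonals-exclusive z
        (resolves-coarsen {D = dist} (_⊓ 2) z cornerDiagonal diag , resolves-coarsen {D = dist} (_⊓ 2) z cornerAntidiagonal anti)

  packing4×3 : List (Pair 4 3)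
  packing4×3 = ((# 0 , # 0) , (# 0 , # 2)) ∷ ((# 0 , # 0) , (# 0 , # 2))
             ∷ ((# 2 , # 1) , (# 3 , # 0)) ∷ ((# 2 , # 1) , (# 3 , # 2)) ∷ ((# 3 , # 0) , (# 3 , # 2)) ∷ []

  packing4×4 : List (Pair 4 4)
  packing4×4 = cornerDiagonal ∷ cornerAntidiagonal ∷ ((# 2 , # 3) , (# 3 , # 2)) ∷ []

  Exceptional : ℕ → ℕ → Set
  Exceptional s t = (s ≡ 2 × t ≡ 2) ⊎ (s ≡ 3 × t ≡ 2) ⊎ (s ≡ 4 × t ≡ 2) ⊎ (s ≡ 3 × t ≡ 3)

  exceptional⊎2<fracDim₁ : ∀ {s t r₁} → t ℕ.≤ s → IsFracDim₁ (2 ℕ.+ s) (2 ℕ.+ t) r₁ →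
                           Exceptional (2 ℕ.+ s) (2 ℕ.+ t) ⊎ 2 · 1ℚ < r₁
  exceptional⊎2<fracDim₁ {0} z≤n             _    = inj₁ (inj₁ (refl , refl))
  exceptional⊎2<fracDim₁ {1} z≤n             _    = inj₁ (inj₂ (inj₁ (refl , refl)))
  exceptional⊎2<fracDim₁ {1} (s≤s z≤n)       _    = inj₁ (inj₂ (inj₂ (inj₂ (refl , refl))))
  exceptional⊎2<fracDim₁ {2} z≤n             _    = inj₁ (inj₂ (inj₂ (inj₁ (refl , refl))))
  exceptional⊎2<fracDim₁ {2} (s≤s z≤n)       dim₁ = inj₂ (packing⇒<min dist₁
    (from-yes (isPacking? dist₁ 2 packing4×3)) (from-yes (2 · (2 · 1ℚ) ℚ.<? 5 · 1ℚ)) dim₁)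
  exceptional⊎2<fracDim₁ {2} (s≤s (s≤s z≤n)) dim₁ = inj₂ (packing⇒<min dist₁
    (from-yes (isPacking? dist₁ 1 packing4×4)) (from-yes (1 · (2 · 1ℚ) ℚ.<? 3 · 1ℚ)) dim₁)
  exceptional⊎2<fracDim₁ {suc (suc (suc _))} _ dim₁ = inj₂ (packing⇒<min dist₁
    cornerAndLastColumnPacking (from-yes (1 · (2 · 1ℚ) ℚ.<? 3 · 1ℚ)) dim₁)

  fracDim₁≤ : ∀ {s t r₁ q} (h : Vertex s t → ℚ) →
              True (isResolvingFn? dist₁ h) → True (total h ℚ.≤? q) → IsFracDim₁ s t r₁ → r₁ ≤ q
  fracDim₁≤ h resolving bounded (_ , minimal) = ≤-trans (minimal h (toWitness resolving)) (toWitness bounded)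

  exceptional⇒fracDim₁≤2 : ∀ {s t r₁} → Exceptional s t → IsFracDim₁ s t r₁ → r₁ ≤ 2 · 1ℚ
  exceptional⇒fracDim₁≤2 (inj₁ (refl , refl)) =
    fracDim₁≤ (uniformOn 1ℚ ((# 0 , # 0) ∷ (# 0 , # 1) ∷ [])) _ _
  exceptional⇒fracDim₁≤2 (inj₂ (inj₁ (refl , refl))) =
    fracDim₁≤ (uniformOn 1ℚ ((# 0 , # 0) ∷ (# 2 , # 0) ∷ [])) _ _
  exceptional⇒fracDim₁≤2 (inj₂ (inj₂ (inj₁ (refl , refl)))) =
    fracDim₁≤ (uniformOn ½ ((# 1 , # 0) ∷ (# 1 , # 1) ∷ (# 2 , # 0) ∷ (# 2 , # 1) ∷ [])) _ _
  exceptional⇒fracDim₁≤2 (inj₂ (inj₂ (inj₂ (refl , refl)))) =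
    fracDim₁≤ (uniformOn ½ ((# 0 , # 1) ∷ (# 1 , # 0) ∷ (# 1 , # 2) ∷ (# 2 , # 1) ∷ [])) _ _

  equal⇒exceptional : ∀ {s t r₁ r} → t ℕ.≤ s → IsFracDim₁ (2 ℕ.+ s) (2 ℕ.+ t) r₁ → IsFracDim (2 ℕ.+ s) (2 ℕ.+ t) r →
                      r₁ ≡ r → Exceptional (2 ℕ.+ s) (2 ℕ.+ t)
  equal⇒exceptional t≤s dim₁ dim r₁≡r with exceptional⊎2<fracDim₁ t≤s dim₁
  ... | inj₁ exceptional = exceptional
  ... | inj₂ 2<r₁        = ⊥-elim (ℚ.<-irrefl (sym r₁≡r) (ℚ.≤-<-trans (fracDim≤2 dim) 2<r₁))

  exceptional⇒equal : ∀ {s t r₁ r} → Exceptional (2 ℕ.+ s) (2 ℕ.+ t) →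
                      IsFracDim₁ (2 ℕ.+ s) (2 ℕ.+ t) r₁ → IsFracDim (2 ℕ.+ s) (2 ℕ.+ t) r → r₁ ≡ r
  exceptional⇒equal exceptional dim₁ dim =
    ℚ.≤-antisym (≤-trans (exceptional⇒fracDim₁≤2 exceptional dim₁) (2≤fracDim dim)) (fracDim≤fracDim₁ dim dim₁)

open import Defs
open import Data.Nat using (ℕ; _≤_; z≤n; s≤s)
open import Data.Rational using (ℚ)
open import Data.Product using (_×_)
open import Data.Sum using (_⊎_)
open import Function.Bundles using (_⇔_; mk⇔)
open import Relation.Binary.PropositionalEquality using (_≡_)
open GridResolution using (equal⇒exceptional; exceptional⇒equal)

proposition3p10 : (s t : ℕ) → 2 ≤ t → t ≤ s →
    (r₁ r : ℚ) → IsFracDim₁ s t r₁ → IsFracDim s t r →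
    (r₁ ≡ r ⇔ ((s ≡ 2 × t ≡ 2) ⊎ (s ≡ 3 × t ≡ 2) ⊎ (s ≡ 4 × t ≡ 2) ⊎ (s ≡ 3 × t ≡ 3)))
proposition3p10 _ _ (s≤s (s≤s z≤n)) (s≤s (s≤s t≤s)) r₁ r dim₁ dim =
  mk⇔ (equal⇒exceptional t≤s dim₁ dim) (λ exceptional → exceptional⇒equal exceptional dim₁ dim)
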